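{- For every complexity measure $\psi$ and every table $T\in\mathcal{M}_k^2$, $\psi^s(T)\le\psi^d(T)$.
   Context: Fix an integer $k\ge 2$; $E_k=\{0,\ldots,k-1\}$, $E_2=\{0,1\}$, $\omega=\{0,1,2,\ldots\}$, $P=\{f_i:i\in\omega\}$ a set of attribute names. $\mathcal{M}_k^2$ is the set of rectangular tables filled with numbers from $E_k$, columns labeled with pairwise different attributes from $P$, rows pairwise different, each row labeled with a decision from $E_2$; the table without rows is denoted $\Lambda$. $P(T)$ is the set of column attributes. $\mathcal{M}_k^2\mathcal{C}$ is the set of tables in which all rows have the same decision ($\Lambda$ included). $T(f_{i_1},\delta_1)\cdots(f_{i_m},\delta_m)$ is the table of rows of $T$ having values $\delta_1,\ldots,\delta_m$ in the columns labeled $f_{i_1},\ldots,f_{i_m}$. A $k$-decision tree: finite directed rooted tree with at least two nodes, root and its leaving edges unlabeled, terminal nodes labeled with decisions from $E_2$, other nodes labeled with attributes from $P$ whose leaving edges are labeled with numbers from $E_k$; $P(\Gamma)$ is the set of attributes labeling nodes. For a complete path $\tau=v_1,d_1,\ldots,v_m,d_m,v_{m+1}$ (root to terminal node), $F(\tau)$ is the empty word if $m=1$, else $f_{i_2}\cdots f_{i_m}$ where $v_j$ is labeled $f_{i_j}$; $T(\tau)=T$ if $m=1$, else $T(f_{i_2},\delta_2)\cdots(f_{i_m},\delta_m)$ with $d_j$ labeled $\delta_j$. For $T\ne\Lambda$, a deterministic decision tree for $T$: exactly one edge leaves the root, edges leaving any other nonterminal node have pairwise different labels, $P(\Gamma)\subseteq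 P(T)$, every row of $T$ lies in some $T(\tau)$, and for every complete path either $T(\tau)=\Lambda$ or all rows of $T(\tau)$ have the terminal node's decision. For $T\notin\mathcal{M}_k^2\mathcal{C}$, a strongly nondeterministic decision tree for $T$: all terminal nodes labeled $1$, $P(\Gamma)\subseteq P(T)$, every row with decision $1$ lies in some $T(\tau)$, and for every complete path either $T(\tau)=\Lambda$ or all rows of $T(\tau)$ have decision $1$. Let $B$ be the set of finite words over $P$ (with empty word $\lambda$). A complexity measure is $\psi:B\to\omega$ with $\psi(\alpha)=0$ iff $\alpha=\lambda$, invariant under permutation of letters, $\psi(\alpha_1)\le\psi(\alpha_1\alpha_2)\le\psi(\alpha_1)+\psi(\alpha_2)$. $\psi(\Gamma)=\max_\tau\psi(F(\tau))$ over complete paths. $\psi^d(\Lambda)=\psi^s(\Lambda)=0$; for $T\ne\Lambda$, $\psi^d(T)$ is the minimum of $\psi(\Gamma)$ over deterministic decision trees for $T$, and $\psi^s(T)=0$ if $T\in\mathcal{M}_k^2\mathcal{C}$ and otherwise the minimum of $\psi(\Gamma)$ over strongly nondeterministic decision trees for $T$. -}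

module Defs where

open import Data.Nat using (ℕ; zero; suc; _+_; _≤_; _⊔_)
open import Data.Fin using (Fin)
open import Data.List using (List; []; _∷_; _++_; map; length; lookup; foldr)
open import Data.List.NonEmpty using (List⁺; _∷_; toList)
open import Data.List.Relation.Unary.All using (All)
open import Data.List.Relation.Unary.Unique.Propositional using (Unique)
open import Data.List.Membership.Propositional using (_∈_)
open import Data.List.Relation.Binary.Permutation.Propositional using (_↭_)
open import Data.Vec as Vec using (Vec)
open import Data.Product using (_×_; _,_; proj₁; proj₂; ∃; ∃-syntax)
open import Data.Sum using (_⊎_)
open import Relation.Nullary using (¬_)
open import Relation.Binary.PropositionalEquality using (_≡_)
open import Function using (_⇔_)

-- Attributes f_i are represented by their index i : ℕ.
-- Decisions (E_2) are Fin 2; values (E_k) are Fin k.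

Attr : Set
Attr = ℕ

one : Fin 2
one = Fin.suc Fin.zero

record Table (k : ℕ) : Set where
  field
    attrs       : List Attr
    attrsUnique : Unique attrs
    rows        : List (Vec (Fin k) (length attrs) × Fin 2)
    rowsUnique  : Unique (map proj₁ rows)
open Table public

Row : ∀ {k} → Table k → Set
Row {k} T = Vec (Fin k) (length (attrs T)) × Fin 2

_∈P_ : ∀ {k} → Attr → Table k → Set
f ∈P T = f ∈ attrs T

IsΛ : ∀ {k} → Table k → Set
IsΛ T = rows T ≡ []

InC : ∀ {k} → Table k → Set
InC T = ∃[ d ] All (λ r → proj₂ r ≡ d) (rows T)

HasValue : ∀ {k} (T : Table k) → Vec (Fin k) (length (attrs T)) → Attr → Fin k → Set
HasValue T v f δ = ∃[ i ] (lookup (attrs T) i ≡ f × Vec.lookup v i ≡ δ)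

InSub : ∀ {k} (T : Table k) → List (Attr × Fin k) → Row T → Set
InSub T cs r = r ∈ rows T × All (λ c → HasValue T (proj₁ r) (proj₁ c) (proj₂ c)) cs

-- The root is unlabelled and has a nonempty list of
-- unlabelled leaving edges (so the tree has at least two nodes).

data Node (k : ℕ) : Set where
  leaf : Fin 2 → Node k
  node : Attr → List⁺ (Fin k × Node k) → Node k

record DTree (k : ℕ) : Set where
  constructor root
  field
    children : List⁺ (Node k)
open DTree public

-- complete paths: each is given by the list of pairs (f_{i_j}, δ_j),
-- j = 2..m, together with the decision labelling the terminal node.
Path : ℕ → Set
Path k = List (Attr × Fin k) × Fin 2

mutual
  pathsN : ∀ {k} → Node k → List (Path k)
  pathsN (leaf b) = (([] , b) ∷ [])
  pathsN (node f (e ∷ es)) = pathsE f e ++ pathsEs f es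

  pathsEs : ∀ {k} → Attr → List (Fin k × Node k) → List (Path k)
  pathsEs f [] = []
  pathsEs f (e ∷ es) = pathsE f e ++ pathsEs f es

  pathsE : ∀ {k} → Attr → Fin k × Node k → List (Path k)
  pathsE f (δ , c) = map (λ p → ((f , δ) ∷ proj₁ p , proj₂ p)) (pathsN c)

pathsNs : ∀ {k} → List (Node k) → List (Path k)
pathsNs [] = []
pathsNs (c ∷ cs) = pathsN c ++ pathsNs cs

paths : ∀ {k} → DTree k → List (Path k)
paths Γ = pathsNs (toList (children Γ))

F : ∀ {k} → Path k → List Attr
F p = map proj₁ (proj₁ p)

data Labels {k : ℕ} (Q : Attr → Set) (R : Fin 2 → Set) : Node k → Set where
  leafL : ∀ {b} → R b → Labels Q R (leaf b)
  nodeL : ∀ {f es} → Q f → All (λ e → Labels Q R (proj₂ e)) (toList es) →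
          Labels Q R (node f es)

data DetN {k : ℕ} : Node k → Set where
  leafD : ∀ {b} → DetN (leaf b)
  nodeD : ∀ {f es} → Unique (map proj₁ (toList es)) →
          All (λ e → DetN (proj₂ e)) (toList es) → DetN (node f es)

AttrsIn : ∀ {k} → DTree k → Table k → Set
AttrsIn Γ T = All (Labels (λ f → f ∈P T) (λ _ → Data.Unit.⊤)) (toList (children Γ))
  where import Data.Unit

record ComplexityMeasure : Set where
  field
    ψ        : List Attr → ℕ
    zero-iff : ∀ α → (ψ α ≡ 0 ⇔ α ≡ [])
    perm     : ∀ {α β} → α ↭ β → ψ α ≡ ψ β
    mono     : ∀ α₁ α₂ → ψ α₁ ≤ ψ (α₁ ++ α₂)
    subadd   : ∀ α₁ α₂ → ψ (α₁ ++ α₂) ≤ ψ α₁ + ψ α₂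
open ComplexityMeasure public

ψΓ : ∀ {k} → ComplexityMeasure → DTree k → ℕ
ψΓ M Γ = foldr _⊔_ 0 (map (λ p → ψ M (F p)) (paths Γ))

IsDeterministicFor : ∀ {k} → DTree k → Table k → Set
IsDeterministicFor Γ T =
    -- exactly one edge leaves the root
    (DTree.children Γ ≡ (Data.List.NonEmpty.head (children Γ) ∷ []))
  × All DetN (toList (children Γ))
  × AttrsIn Γ T
  × (∀ r → r ∈ rows T → ∃[ p ] (p ∈ paths Γ × InSub T (proj₁ p) r))
  × All (λ p → (∀ r → ¬ InSub T (proj₁ p) r)
             ⊎ (∀ r → InSub T (proj₁ p) r → proj₂ r ≡ proj₂ p))
        (paths Γ)

IsStronglyNondetFor : ∀ {k} → DTree k → Table k → Set
IsStronglyNondetFor Γ T =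
    All (Labels (λ _ → Data.Unit.⊤) (λ b → b ≡ one)) (toList (children Γ))
  × AttrsIn Γ T
  × (∀ r → r ∈ rows T → proj₂ r ≡ one → ∃[ p ] (p ∈ paths Γ × InSub T (proj₁ p) r))
  × All (λ p → (∀ r → ¬ InSub T (proj₁ p) r)
             ⊎ (∀ r → InSub T (proj₁ p) r → proj₂ r ≡ one))
        (paths Γ)
  where import Data.Unit

PsiD≡ : ∀ {k} → ComplexityMeasure → Table k → ℕ → Set
PsiD≡ M T m =
  (IsΛ T × m ≡ 0) ⊎
  (¬ IsΛ T × (∃[ Γ ] (IsDeterministicFor Γ T × ψΓ M Γ ≡ m))
           × (∀ Γ → IsDeterministicFor Γ T → m ≤ ψΓ M Γ))

PsiS≡ : ∀ {k} → ComplexityMeasure → Table k → ℕ → Set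
PsiS≡ M T m =
  (IsΛ T × m ≡ 0) ⊎
  (InC T × m ≡ 0) ⊎
  (¬ InC T × (∃[ Γ ] (IsStronglyNondetFor Γ T × ψΓ M Γ ≡ m))
           × (∀ Γ → IsStronglyNondetFor Γ T → m ≤ ψΓ M Γ))

-- Keep the complete paths of a deterministic decision tree for T that end in
-- decision 1 and hang each of them, as a separate unbranched chain, below a common root.
-- A row with decision 1 lies in the path that the deterministic tree sends it along, and
-- that path ends in 1, so the new tree is strongly nondeterministic for T.  Its complete
-- paths are complete paths of the old tree, hence its complexity is no larger.  The root
-- needs at least one child; since T ∉ M_k^2 C, some row has decision 1 and its path serves.
module Submission where

open import Defs
open import Data.Nat using (ℕ; _≤_; z≤n; _⊔_)
open import Data.Nat.Properties using (≤-refl; ≤-trans; ⊔-lub; m⊔n≤o⇒m≤o; m⊔n≤o⇒n≤o)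
open import Data.Fin using (Fin; zero; suc; _≟_)
open import Data.List using (List; []; _∷_; map; filter)
open import Data.List.Properties using (foldr-forcesᵇ; foldr-preservesᵇ)
open import Data.List.NonEmpty as List⁺ using (List⁺; _∷_; toList)
open import Data.List.Relation.Unary.All as All using (All; []; _∷_)
open import Data.List.Relation.Unary.All.Properties using (++⁺; map⁺; map⁻; ¬Any⇒All¬)
open import Data.List.Relation.Unary.Any using (any?; there)
open import Data.List.Membership.Propositional using (_∈_; find)
open import Data.List.Membership.Propositional.Properties using (∈-filter⁺; ∈-filter⁻)
open import Data.Product using (_×_; _,_; proj₁; proj₂; ∃-syntax)
open import Data.Sum using (_⊎_; inj₁; inj₂)
open import Data.Unit using (⊤; tt)
open import Data.Empty using (⊥-elim)
open import Function using (_∘_)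
open import Relation.Nullary using (¬_; yes; no)
open import Relation.Unary using (Decidable)
open import Relation.Binary.PropositionalEquality using (_≡_; _≢_; refl; sym; trans; subst)

module _ {k : ℕ} where

  chain : Path k → Node k
  chain ([] , b) = leaf b
  chain ((f , δ) ∷ q , b) = node f ((δ , chain (q , b)) ∷ [])

  pathsN-chain : (p : Path k) → pathsN (chain p) ≡ p ∷ []
  pathsN-chain ([] , b) = refl
  pathsN-chain ((f , δ) ∷ q , b) rewrite pathsN-chain (q , b) = refl

  pathsNs-map-chain : (ps : List (Path k)) → pathsNs (map chain ps) ≡ ps
  pathsNs-map-chain [] = refl
  pathsNs-map-chain (p ∷ ps) rewrite pathsN-chain p | pathsNs-map-chain ps = refl

  pathsTree : List⁺ (Path k) → DTree k
  pathsTree ps = root (List⁺.map chain ps)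

  paths-pathsTree : (ps : List⁺ (Path k)) → paths (pathsTree ps) ≡ toList ps
  paths-pathsTree ps = pathsNs-map-chain (toList ps)

  AttrsSatisfy : (Attr → Set) → Path k → Set
  AttrsSatisfy Q p = All (Q ∘ proj₁) (proj₁ p)

  chain-labels : ∀ {Q R} (p : Path k) → AttrsSatisfy Q p → R (proj₂ p) → Labels Q R (chain p)
  chain-labels ([] , b) [] rb = leafL rb
  chain-labels ((f , δ) ∷ q , b) (qf ∷ qq) rb = nodeL qf (chain-labels (q , b) qq rb ∷ [])

  module _ {Q : Attr → Set} {R : Fin 2 → Set} where

    mutual
      labels⇒pathsN : ∀ {n : Node k} → Labels Q R n → All (AttrsSatisfy Q) (pathsN n)
      labels⇒pathsN (leafL _) = [] ∷ []
      labels⇒pathsN (nodeL {es = _ ∷ _} qf (le ∷ les)) =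
        ++⁺ (labels⇒pathsE qf le) (labels⇒pathsEs qf les)

      labels⇒pathsEs : ∀ {f} {es : List (Fin k × Node k)} → Q f →
                       All (Labels Q R ∘ proj₂) es → All (AttrsSatisfy Q) (pathsEs f es)
      labels⇒pathsEs qf [] = []
      labels⇒pathsEs qf (le ∷ les) = ++⁺ (labels⇒pathsE qf le) (labels⇒pathsEs qf les)

      labels⇒pathsE : ∀ {f} {e : Fin k × Node k} → Q f →
                      Labels Q R (proj₂ e) → All (AttrsSatisfy Q) (pathsE f e)
      labels⇒pathsE qf le = map⁺ (All.map (qf ∷_) (labels⇒pathsN le))

    labels⇒paths : ∀ {Γ : DTree k} → All (Labels Q R) (toList (children Γ)) →
                   All (AttrsSatisfy Q) (paths Γ)
    labels⇒paths {Γ} = go (toList (children Γ))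
      where
        go : (ns : List (Node k)) → All (Labels Q R) ns → All (AttrsSatisfy Q) (pathsNs ns)
        go [] [] = []
        go (_ ∷ ns) (ln ∷ lns) = ++⁺ (labels⇒pathsN ln) (go ns lns)

module _ {k : ℕ} (M : ComplexityMeasure) where

  ψΓ-bounds-paths : (Γ : DTree k) → All (λ p → ψ M (F p) ≤ ψΓ M Γ) (paths Γ)
  ψΓ-bounds-paths Γ = map⁻ (foldr-forcesᵇ {P = _≤ ψΓ M Γ} split 0 _ ≤-refl)
    where
      split : ∀ m n → m ⊔ n ≤ ψΓ M Γ → m ≤ ψΓ M Γ × n ≤ ψΓ M Γ
      split m n m⊔n≤ = m⊔n≤o⇒m≤o m n m⊔n≤ , m⊔n≤o⇒n≤o m n m⊔n≤

  ψΓ-least : ∀ {n} (Γ : DTree k) → All (λ p → ψ M (F p) ≤ n) (paths Γ) → ψΓ M Γ ≤ n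
  ψΓ-least {n} Γ bounded = foldr-preservesᵇ {P = _≤ n} ⊔-lub z≤n (map⁺ bounded)

  ψΓ-mono-paths : ∀ (Γ′ Γ : DTree k) → (∀ {p} → p ∈ paths Γ′ → p ∈ paths Γ) → ψΓ M Γ′ ≤ ψΓ M Γ
  ψΓ-mono-paths Γ′ Γ sub = ψΓ-least Γ′ (All.tabulate (All.lookup (ψΓ-bounds-paths Γ) ∘ sub))

≢one⇒≡zero : {b : Fin 2} → b ≢ one → b ≡ zero
≢one⇒≡zero {zero} _ = refl
≢one⇒≡zero {suc zero} b≢one = ⊥-elim (b≢one refl)

module _ {k : ℕ} (T : Table k) where

  SubtableHasDecision : Fin 2 → List (Attr × Fin k) → Set
  SubtableHasDecision b q = (∀ r → ¬ InSub T q r) ⊎ (∀ r → InSub T q r → proj₂ r ≡ b)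

  decision-along-path : ∀ {ps : List (Path k)} →
                        All (λ p → SubtableHasDecision (proj₂ p) (proj₁ p)) ps →
                        ∀ {p r} → p ∈ ps → InSub T (proj₁ p) r → proj₂ r ≡ proj₂ p
  decision-along-path correct p∈ps r∈p with All.lookup correct p∈ps
  ... | inj₁ noRow = ⊥-elim (noRow _ r∈p)
  ... | inj₂ allHaveIt = allHaveIt _ r∈p

  Λ-InC : IsΛ T → InC T
  Λ-InC isΛ = zero , subst (All _) (sym isΛ) []

  ¬InC⇒row-with-one : ¬ InC T → ∃[ r ] (r ∈ rows T × proj₂ r ≡ one)
  ¬InC⇒row-with-one ¬inC with any? (λ r → proj₂ r ≟ one) (rows T)
  ... | yes someOne = find someOne
  ... | no noOne = ⊥-elim (¬inC (zero , All.map ≢one⇒≡zero (¬Any⇒All¬ (rows T) noOne)))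

  deterministic⇒stronglyNondet :
    ∀ {Γ r} → IsDeterministicFor Γ T → r ∈ rows T → proj₂ r ≡ one →
    ∃[ Γ′ ] (IsStronglyNondetFor Γ′ T × (∀ {p} → p ∈ paths Γ′ → p ∈ paths Γ))
  deterministic⇒stronglyNondet {Γ} (_ , _ , attrsIn , cover , correct) r∈T r≡one =
    pathsTree ps , (leavesOne , attrsInT , coverOne , correctOne) , pathOfΓ
    where
      Kept : Path k → Set
      Kept p = p ∈ paths Γ × proj₂ p ≡ one

      coveringPath : ∀ {r} → r ∈ rows T → proj₂ r ≡ one → ∃[ p ] (Kept p × InSub T (proj₁ p) r)
      coveringPath {r} r∈T r≡one =
        let p , p∈Γ , r∈p = cover r r∈T
        in p , (p∈Γ , trans (sym (decision-along-path correct p∈Γ r∈p)) r≡one) , r∈p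

      endsInOne? : Decidable {A = Path k} ((_≡ one) ∘ proj₂)
      endsInOne? p = proj₂ p ≟ one

      ps : List⁺ (Path k)
      ps = proj₁ (coveringPath r∈T r≡one) ∷ filter endsInOne? (paths Γ)

      keptPs : All Kept (toList ps)
      keptPs = proj₁ (proj₂ (coveringPath r∈T r≡one)) ∷ All.tabulate (∈-filter⁻ endsInOne?)

      ps≡ : toList ps ≡ paths (pathsTree ps)
      ps≡ = sym (paths-pathsTree ps)

      pathOfΓ : ∀ {p} → p ∈ paths (pathsTree ps) → p ∈ paths Γ
      pathOfΓ = proj₁ ∘ All.lookup (subst (All Kept) ps≡ keptPs)

      leavesOne : All (Labels (λ _ → ⊤) (_≡ one)) (map chain (toList ps))
      leavesOne = map⁺ (All.map (λ { {p} (_ , p≡one) → chain-labels p (All.universal _ _) p≡one })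
                                keptPs)

      attrsInT : AttrsIn (pathsTree ps) T
      attrsInT = map⁺ (All.map (λ { {p} (p∈Γ , _) → chain-labels p (attrsOf p∈Γ) tt }) keptPs)
        where
          attrsOf : ∀ {p} → p ∈ paths Γ → AttrsSatisfy (_∈P T) p
          attrsOf = All.lookup (labels⇒paths attrsIn)

      coverOne : ∀ r → r ∈ rows T → proj₂ r ≡ one →
                 ∃[ p ] (p ∈ paths (pathsTree ps) × InSub T (proj₁ p) r)
      coverOne r r∈T r≡one =
        let p , (p∈Γ , p≡one) , r∈p = coveringPath r∈T r≡one
        in p , subst (p ∈_) ps≡ (there (∈-filter⁺ endsInOne? p∈Γ p≡one)) , r∈p

      correctOne : All (SubtableHasDecision one ∘ proj₁) (paths (pathsTree ps))
      correctOne = subst (All _) ps≡ (All.map keptCorrect keptPs)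
        where
          keptCorrect : ∀ {p} → Kept p → SubtableHasDecision one (proj₁ p)
          keptCorrect {p} (p∈Γ , p≡one) =
            subst (λ b → SubtableHasDecision b (proj₁ p)) p≡one (All.lookup correct p∈Γ)

lemma8 : (k : ℕ) → 2 ≤ k → (M : ComplexityMeasure) → (T : Table k) →
    (md ms : ℕ) → PsiD≡ M T md → PsiS≡ M T ms → ms ≤ md
lemma8 k _ M T md ms _ (inj₁ (_ , refl)) = z≤n
lemma8 k _ M T md ms _ (inj₂ (inj₁ (_ , refl))) = z≤n
lemma8 k _ M T md ms (inj₁ (isΛ , _)) (inj₂ (inj₂ (¬inC , _))) = ⊥-elim (¬inC (Λ-InC T isΛ))
lemma8 k _ M T md ms (inj₂ (_ , (Γ , det , refl) , _)) (inj₂ (inj₂ (¬inC , _ , minimalS))) =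
  let r , r∈T , r≡one = ¬InC⇒row-with-one T ¬inC
      Γ′ , nondet , pathsOfΓ = deterministic⇒stronglyNondet T det r∈T r≡one
  in ≤-trans (minimalS Γ′ nondet) (ψΓ-mono-paths M Γ′ Γ pathsOfΓ)
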